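{- Let $y$ be a cubic number for which $\alpha_0 + \alpha_1 y + \alpha_2 y^2 + y^3 = 0$, where $\alpha_0, \alpha_1,\alpha_2 \in \mathbb{Q}$, and let $x = \gamma_0 + \gamma_1 y + \gamma_2 y^2$, where $\gamma_0, \gamma_1, \gamma_2 \in \mathbb{Q}$. Let $\vec{v_2} = \begin{pmatrix}1\\ x\\ y\end{pmatrix}$, resp. $\vec{v_3} = \begin{pmatrix}y\\ 1\\ x\end{pmatrix}$. Then \[ Q_{2,\vec{v_2}} = \left( \begin{pmatrix} c_6 & 1 & c_3 \\ c_4& 0 & c_1 \\ c_5& 0 & c_2 \end{pmatrix}, \begin{pmatrix} 1&0&0\\ 0&1&0\\ 0&0&1 \end{pmatrix}, \begin{pmatrix} c_3& 0 & b_3 \\ c_1& 0 & b_1 \\ c_2& 1 & b_2 \end{pmatrix} \right), \] resp. \[ Q_{3,\vec{v_3}} = \left(\begin{pmatrix} b_2 & c_2 & 1 \\ b_3 & c_3 & 0\\ b_1 & c_1 & 0 \end{pmatrix}, \begin{pmatrix} c_2 & c_5 & 0 \\ c_3 & c_6 & 1\\ c_1 & c_4 & 0 \end{pmatrix}, \begin{pmatrix} 1&0&0\\ 0&1&0\\ 0&0&1 \end{pmatrix} \right),\] where \begin{align*} b_1 &= \gamma_2\gamma_0+\gamma_1\alpha_2\gamma_2-\gamma_1^2-\alpha_1\gamma_2^2, & b_2 &= \alpha_2\gamma_2-2\gamma_1, & b_3 &= \gamma_2,\\ c_1 &= \gamma_0\alpha_2\gamma_2-\gamma_0\gamma_1-\alpha_0\gamma_2^2,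 & c_2 &=-\gamma_0, & c_3 &= \alpha_2\gamma_2-\gamma_1,\\ c_4 &=\gamma_0\alpha_1\gamma_2-\gamma_0^2-\alpha_0\gamma_2\gamma_1, & c_5 &=-\alpha_0\gamma_2, & c_6 &=\alpha_1\gamma_2-2\gamma_0, \end{align*} equivalently $\gamma_0 = -c_2$, $\gamma_1 = c_3-b_2$, $\gamma_2 = b_3$, $\alpha_0 = \frac{ -c_1-c_3c_2}{b_3^2}$, $\alpha_1 = \frac{c_3^2-b_1-b_3c_2-b_2c_3}{b_3^2}$, $\alpha_2 = \frac{2c_3 - b_2}{b_3}$, and $c_4 = \frac{c_1c_3-c_1b_2+c_2b_1}{b_3}$, $c_5 = \frac{c_3c_2+c_1}{b_3}$, $c_6 = \frac{c_3^2+b_3c_2-b_1-b_2c_3}{b_3}$.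
   Context: For a basis $\vec{v} = (v_1,\dots,v_n)^T$ of a number field $\mathbb{Q}(v_1,\dots,v_n)$ of degree $n$ (as a vector space over $\mathbb{Q}$) and $\lambda$ in that field, $T_\lambda^{\vec{v}}$ denotes the matrix of the linear map $z\mapsto \lambda z$ in the basis $\vec{v}$; equivalently $M=(T_\lambda^{\vec{v}})^T$ is the unique matrix with $M\vec{v}=\lambda\vec{v}$. For $\ell\in\{1,\dots,n\}$, $Q_{\ell,\vec{v}}$ denotes the (unique) $n$-tuple of matrices in $\mathbb{Q}^{n,n}$ such that for every $\lambda$ in the field, with $M=(T_\lambda^{\vec{v}})^T$, the $i$-th column of $M$ equals $(Q_{\ell,\vec{v}})_i$ times the $\ell$-th column $M_{\bullet,\ell}$ of $M$. For the vector $\vec{v}=(x,y,1)^T$ with $x,y$ as in the claim one has $Q_{1,\vec{v}} = \left(I, \begin{pmatrix} 0 & b_1 & c_1 \\ 1 & b_2 & c_2 \\ 0 & b_3 & c_3 \end{pmatrix}, \begin{pmatrix} 0 & c_1 & c_4 \\ 0 & c_2 & c_5 \\ 1 & c_3 & c_6 \end{pmatrix}\right)$ with $I$ the $3\times 3$ identity and the $b_i,c_i$ given by the formulas in the claim. -}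

module Defs where

open import Level using (Level)
open import Data.Fin using (Fin; zero; suc)
open import Data.Product using (Σ; _×_)
open import Relation.Binary.PropositionalEquality using (_≡_)
open import Data.Rational as Q using (ℚ; 0ℚ; 1ℚ)
open import Data.Rational.Properties using (+-*-commutativeRing)
open import Algebra.Bundles using (CommutativeRing)
open import Algebra.Morphism.Structures using (module RingMorphisms)

-- 3x3 rational matrices, indexed (row, column), indices 0-based.
Mat : Set
Mat = Fin 3 → Fin 3 → ℚ

-- a triple of matrices ((Q)_1, (Q)_2, (Q)_3), 0-based
Triple : Set
Triple = Fin 3 → Mat

Σ3ℚ : (Fin 3 → ℚ) → ℚ
Σ3ℚ f = f zero Q.+ (f (suc zero) Q.+ f (suc (suc zero)))

mat : ℚ → ℚ → ℚ → ℚ → ℚ → ℚ → ℚ → ℚ → ℚ → Mat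
mat a b c d e f g h i zero zero = a
mat a b c d e f g h i zero (suc zero) = b
mat a b c d e f g h i zero (suc (suc zero)) = c
mat a b c d e f g h i (suc zero) zero = d
mat a b c d e f g h i (suc zero) (suc zero) = e
mat a b c d e f g h i (suc zero) (suc (suc zero)) = f
mat a b c d e f g h i (suc (suc zero)) zero = g
mat a b c d e f g h i (suc (suc zero)) (suc zero) = h
mat a b c d e f g h i (suc (suc zero)) (suc (suc zero)) = i

I3 : Mat
I3 = mat 1ℚ 0ℚ 0ℚ 0ℚ 1ℚ 0ℚ 0ℚ 0ℚ 1ℚ

triple : Mat → Mat → Mat → Triple
triple A B C zero = A
triple A B C (suc zero) = B
triple A B C (suc (suc zero)) = C

module Consts (α₀ α₁ α₂ γ₀ γ₁ γ₂ : ℚ) where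
  open Q using (_+_; _*_; _-_; -_)
  two : ℚ
  two = 1ℚ + 1ℚ
  b₁ b₂ b₃ c₁ c₂ c₃ c₄ c₅ c₆ : ℚ
  b₁ = γ₂ * γ₀ + γ₁ * α₂ * γ₂ - γ₁ * γ₁ - α₁ * γ₂ * γ₂
  b₂ = α₂ * γ₂ - two * γ₁
  b₃ = γ₂
  c₁ = γ₀ * α₂ * γ₂ - γ₀ * γ₁ - α₀ * γ₂ * γ₂
  c₂ = - γ₀
  c₃ = α₂ * γ₂ - γ₁
  c₄ = γ₀ * α₁ * γ₂ - γ₀ * γ₀ - α₀ * γ₂ * γ₁
  c₅ = - (α₀ * γ₂)
  c₆ = α₁ * γ₂ - two * γ₀

  Q2 : Triple
  Q2 = triple (mat c₆ 1ℚ c₃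
                   c₄ 0ℚ c₁
                   c₅ 0ℚ c₂)
              I3
              (mat c₃ 0ℚ b₃
                   c₁ 0ℚ b₁
                   c₂ 1ℚ b₂)

  Q3 : Triple
  Q3 = triple (mat b₂ c₂ 1ℚ
                   b₃ c₃ 0ℚ
                   b₁ c₁ 0ℚ)
              (mat c₂ c₅ 0ℚ
                   c₃ c₆ 1ℚ
                   c₁ c₄ 0ℚ)
              I3

-- Ambient: a commutative ring R with a ring homomorphism ι : ℚ → R
-- (i.e. a ℚ-algebra; e.g. R = ℂ).
module Ambient {c ℓ : Level} (R : CommutativeRing c ℓ)
               (ι : ℚ → CommutativeRing.Carrier R) where
  open CommutativeRing R using (Carrier; _≈_; _+_; _*_; 0#; rawRing)

  IsQAlgebra : Set ℓ
  IsQAlgebra = RingMorphisms.IsRingHomomorphism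
                 (CommutativeRing.rawRing +-*-commutativeRing) rawRing ι

  Σ3 : (Fin 3 → Carrier) → Carrier
  Σ3 f = f zero + (f (suc zero) + f (suc (suc zero)))

  -- λ lies in the ℚ-span of the entries of v
  -- (= the field ℚ(v1,v2,v3) when v is a basis of it).
  InField : (Fin 3 → Carrier) → Carrier → Set ℓ
  InField v z = Σ (Fin 3 → ℚ) (λ q → z ≈ Σ3 (λ j → ι (q j) * v j))

  Represents : Mat → Carrier → (Fin 3 → Carrier) → Set ℓ
  Represents M z v = ∀ i → Σ3 (λ j → ι (M i j) * v j) ≈ z * v i

  -- Q is Q_{ℓ',v} : for every λ in the field and M = (T_λ^v)^T,
  -- the i-th column of M equals Q_i times the ℓ'-th column of M.
  IsQ : Fin 3 → (Fin 3 → Carrier) → Triple → Set (c Level.⊔ ℓ)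
  IsQ l v Q = ∀ z → InField v z → ∀ M → Represents M z v →
              ∀ i k → M k i ≡ Σ3ℚ (λ j → Q i k j Q.* M j l)

  IsRoot : ℚ → ℚ → ℚ → Carrier → Set ℓ
  IsRoot α₀ α₁ α₂ y = ι α₀ + ι α₁ * y + ι α₂ * (y * y) + y * (y * y) ≈ 0#

  Deg≥3 : Carrier → Set ℓ
  Deg≥3 y = ∀ (q₀ q₁ q₂ : ℚ) → ι q₀ + ι q₁ * y + ι q₂ * (y * y) ≈ 0# →
            (q₀ ≡ 0ℚ) × (q₁ ≡ 0ℚ) × (q₂ ≡ 0ℚ)

  vec : Carrier → Carrier → Carrier → Fin 3 → Carrier
  vec a b d zero = a
  vec a b d (suc zero) = b
  vec a b d (suc (suc zero)) = d

  xOf : ℚ → ℚ → ℚ → Carrier → Carrier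
  xOf γ₀ γ₁ γ₂ y = ι γ₀ + ι γ₁ * y + ι γ₂ * (y * y)

module Submission where

open import Defs
open import Level using (Level)
open import Data.Fin using (Fin; zero; suc; #_)
open import Data.Product using (_×_; _,_)
open import Relation.Binary.PropositionalEquality using (_≢_; _≡_)
open import Data.Rational using (ℚ; 0ℚ; 1ℚ; 1/_)
open import Algebra.Bundles using (CommutativeRing)

import Relation.Binary.PropositionalEquality as ≡
import Relation.Binary.Reasoning.Setoid as ≈-Reasoning
open import Function using (id; _∘_)
open import Data.Nat as ℕ using (ℕ)
import Data.Maybe as Maybe
open import Data.Vec as Vec using (Vec; _∷_; []; lookup)
import Data.Vec.Properties as Vec
open import Relation.Nullary.Decidable using (dec⇒maybe)
import Data.Rational as ℚ
import Data.Rational.Properties as ℚ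
open import Algebra.Bundles.Raw using (RawRing)
open import Algebra.Morphism.Structures using (module RingMorphisms)
open RingMorphisms using (IsRingHomomorphism)
import Algebra.Morphism.Construct.Identity as Identity
import Algebra.Properties.Group ℚ.+-0-group as ℚ-Group
import Algebra.Solver.Ring.AlmostCommutativeRing as ACR
import Algebra.Solver.Ring
open import Tactic.RingSolver.Core.Expression using (Expr; Κ; Ι; _⊕_; _⊗_; _⊛_; ⊝_; module Eval)

-- Write elements of ℚ(y) by their coordinates in the basis (1, y, y²); multiplication
-- becomes reduction modulo y³ + α₂y² + α₁y + α₀, and Deg≥3 makes the coordinates
-- unique. The relation M v = λ v, with λ = Σ qⱼ vⱼ, then says that row k of M is the
-- coordinate vector of λ vₖ with respect to v. The coordinate matrix of v has
-- determinant ±γ₂, so γ₂ M is an explicit polynomial matrix in α, γ and q, and the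
-- claimed column relations become polynomial identities, checked by a ring solver.

module Coordinates {c ℓ} (A : RawRing c ℓ) where
  open RawRing A

  infixl 6 _-_
  _-_ : Carrier → Carrier → Carrier
  x - y = x + - y

  sum₃ : (Fin 3 → Carrier) → Carrier
  sum₃ f = f zero + (f (suc zero) + f (suc (suc zero)))

  Coords : Set c
  Coords = Carrier × Carrier × Carrier

  coord : Coords → Fin 3 → Carrier
  coord (a , _ , _) zero = a
  coord (_ , b , _) (suc zero) = b
  coord (_ , _ , d) (suc (suc zero)) = d

  eval : Coords → Carrier → Carrier
  eval (a₀ , a₁ , a₂) Y = a₀ + a₁ * Y + a₂ * (Y * Y)

  infixl 6 _⊖_
  _⊖_ : Coords → Coords → Coords
  (a₀ , a₁ , a₂) ⊖ (b₀ , b₁ , b₂) = a₀ - b₀ , a₁ - b₁ , a₂ - b₂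

  lincomb : (Fin 3 → Carrier) → (Fin 3 → Coords) → Coords
  lincomb m W = sum₃ (λ j → m j * coord (W j) zero)
              , sum₃ (λ j → m j * coord (W j) (suc zero))
              , sum₃ (λ j → m j * coord (W j) (suc (suc zero)))

  module Cubic (α₀ α₁ α₂ : Carrier) where
    minimal : Carrier → Carrier
    minimal Y = α₀ + α₁ * Y + α₂ * (Y * Y) + Y * (Y * Y)

    infixl 7 _⊙_
    _⊙_ : Coords → Coords → Coords
    (a₀ , a₁ , a₂) ⊙ (b₀ , b₁ , b₂) =
        s₀ - α₀ * s₃ + α₂ * α₀ * s₄
      , s₁ - α₁ * s₃ + (α₂ * α₁ - α₀) * s₄
      , s₂ - α₂ * s₃ + (α₂ * α₂ - α₁) * s₄
      where
      s₀ = a₀ * b₀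
      s₁ = a₀ * b₁ + a₁ * b₀
      s₂ = a₀ * b₂ + (a₁ * b₁ + a₂ * b₀)
      s₃ = a₁ * b₂ + a₂ * b₁
      s₄ = a₂ * b₂

    quotient : Coords → Coords → Carrier → Carrier
    quotient (_ , a₁ , a₂) (_ , b₁ , b₂) Y =
      a₁ * b₂ + a₂ * b₁ + a₂ * b₂ * Y - a₂ * b₂ * α₂

    -- If rebase multiplies by d the coordinates with respect to W, this is d (T_λ^W)^T,
    -- i.e. d times the matrix M with M W = λ W, for λ = Σ qⱼ Wⱼ.
    multiplicationMatrix : (Coords → Coords) → (Fin 3 → Coords) → (Fin 3 → Carrier) →
                           Fin 3 → Fin 3 → Carrier
    multiplicationMatrix rebase W q k i = coord (rebase (lincomb q W ⊙ W k)) i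

  -- basis₂ and basis₃ are the coordinates of v₂ = (1, x, y) and v₃ = (y, 1, x), where
  -- x = γ₀ + γ₁ y + γ₂ y²; rebaseₙ multiplies by γ₂ the coordinates w.r.t. basisₙ.
  module Frames (γ₀ γ₁ γ₂ : Carrier) where
    basis₂ basis₃ : Fin 3 → Coords
    basis₂ = lookup ((1# , 0# , 0#) ∷ (γ₀ , γ₁ , γ₂) ∷ (0# , 1# , 0#) ∷ [])
    basis₃ = lookup ((0# , 1# , 0#) ∷ (1# , 0# , 0#) ∷ (γ₀ , γ₁ , γ₂) ∷ [])

    rebase₂ rebase₃ : Coords → Coords
    rebase₂ (c₀ , c₁ , c₂) = γ₂ * c₀ - γ₀ * c₂ , c₂ , γ₂ * c₁ - γ₁ * c₂
    rebase₃ (c₀ , c₁ , c₂) = γ₂ * c₁ - γ₁ * c₂ , γ₂ * c₀ - γ₀ * c₂ , c₂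

  matrix : Vec (Vec Carrier 3) 3 → Fin 3 → Fin 3 → Carrier
  matrix rows k j = lookup (lookup rows k) j

  identity : Fin 3 → Fin 3 → Carrier
  identity = matrix ((1# ∷ 0# ∷ 0# ∷ []) ∷ (0# ∷ 1# ∷ 0# ∷ []) ∷ (0# ∷ 0# ∷ 1# ∷ []) ∷ [])

  -- Consts of Defs over an arbitrary raw ring, so that Q₂ and Q₃ can be written as
  -- solver polynomials; at ℚ they agree definitionally with Consts.Q2 and Consts.Q3.
  module Constants (α₀ α₁ α₂ γ₀ γ₁ γ₂ : Carrier) where
    two : Carrier
    two = 1# + 1#

    b₁ b₂ b₃ c₁ c₂ c₃ c₄ c₅ c₆ : Carrier
    b₁ = γ₂ * γ₀ + γ₁ * α₂ * γ₂ - γ₁ * γ₁ - α₁ * γ₂ * γ₂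
    b₂ = α₂ * γ₂ - two * γ₁
    b₃ = γ₂
    c₁ = γ₀ * α₂ * γ₂ - γ₀ * γ₁ - α₀ * γ₂ * γ₂
    c₂ = - γ₀
    c₃ = α₂ * γ₂ - γ₁
    c₄ = γ₀ * α₁ * γ₂ - γ₀ * γ₀ - α₀ * γ₂ * γ₁
    c₅ = - (α₀ * γ₂)
    c₆ = α₁ * γ₂ - two * γ₀

    Q₂ Q₃ : Fin 3 → Fin 3 → Fin 3 → Carrier
    Q₂ = lookup (matrix ((c₆ ∷ 1# ∷ c₃ ∷ []) ∷ (c₄ ∷ 0# ∷ c₁ ∷ []) ∷ (c₅ ∷ 0# ∷ c₂ ∷ []) ∷ [])
               ∷ identity
               ∷ matrix ((c₃ ∷ 0# ∷ b₃ ∷ []) ∷ (c₁ ∷ 0# ∷ b₁ ∷ []) ∷ (c₂ ∷ 1# ∷ b₂ ∷ []) ∷ [])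
               ∷ [])
    Q₃ = lookup (matrix ((b₂ ∷ c₂ ∷ 1# ∷ []) ∷ (b₃ ∷ c₃ ∷ 0# ∷ []) ∷ (b₁ ∷ c₁ ∷ 0# ∷ []) ∷ [])
               ∷ matrix ((c₂ ∷ c₅ ∷ 0# ∷ []) ∷ (c₃ ∷ c₆ ∷ 1# ∷ []) ∷ (c₁ ∷ c₄ ∷ 0# ∷ []) ∷ [])
               ∷ identity
               ∷ [])

module ℚ³ = Coordinates ℚ.+-*-rawRing

map₃ : ∀ {a b} {A : Set a} {B : Set b} → (A → B) → A × A × A → B × B × B
map₃ f (a₀ , a₁ , a₂) = f a₀ , f a₁ , f a₂

module QAlgebraSolver {c ℓ} (R : CommutativeRing c ℓ)
  (ι : ℚ → CommutativeRing.Carrier R) (ι-hom : Ambient.IsQAlgebra R ι) where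
  open CommutativeRing R using (reflexive)
  open IsRingHomomorphism ι-hom

  private
    ι-morphism : ℚ.+-*-rawRing ACR.-Raw-AlmostCommutative⟶ ACR.fromCommutativeRing R
    ι-morphism = record
      { ⟦_⟧ = ι ; +-homo = +-homo ; *-homo = *-homo ; -‿homo = -‿homo
      ; 0-homo = 0#-homo ; 1-homo = 1#-homo }

  open Algebra.Solver.Ring ℚ.+-*-rawRing (ACR.fromCommutativeRing R) ι-morphism
    (λ p q → Maybe.map (reflexive ∘ ≡.cong ι) (dec⇒maybe (p ℚ.≟ q)))
    public using (Polynomial; solve; _:=_; _:+_; _:*_; :-_; con)

  polynomialRawRing : ℕ → RawRing _ _
  polynomialRawRing n = record
    { Carrier = Polynomial n ; _≈_ = _≡_ ; _+_ = _:+_ ; _*_ = _:*_ ; -_ = :-_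
    ; 0# = con 0ℚ ; 1# = con 1ℚ }

  module Poly (n : ℕ) = Coordinates (polynomialRawRing n)

*-cancelˡ : ∀ {d a b} → d ≢ 0ℚ → d ℚ.* a ≡ d ℚ.* b → a ≡ b
*-cancelˡ {d} {a} {b} d≢0 eq = begin
  a                   ≡⟨ recover a ⟨
  1/ d ℚ.* (d ℚ.* a)  ≡⟨ ≡.cong (1/ d ℚ.*_) eq ⟩
  1/ d ℚ.* (d ℚ.* b)  ≡⟨ recover b ⟩
  b                   ∎
  where
  open ≡.≡-Reasoning
  instance _ = ℚ.≢-nonZero d≢0
  recover : ∀ x → 1/ d ℚ.* (d ℚ.* x) ≡ x
  recover x = begin
    1/ d ℚ.* (d ℚ.* x)  ≡⟨ ℚ.*-assoc (1/ d) d x ⟨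
    1/ d ℚ.* d ℚ.* x    ≡⟨ ≡.cong (ℚ._* x) (ℚ.*-inverseˡ d) ⟩
    1ℚ ℚ.* x            ≡⟨ ℚ.*-identityˡ x ⟩
    x                   ∎

record Frame : Set where
  field
    basis : Fin 3 → ℚ³.Coords
    rebase : ℚ³.Coords → ℚ³.Coords
    scale : ℚ
    scale≢0 : scale ≢ 0ℚ
    rebase-lincomb : ∀ m i → ℚ³.coord (rebase (ℚ³.lincomb m basis)) i ≡ scale ℚ.* m i

module ℚ-Identities where
  open QAlgebraSolver ℚ.+-*-commutativeRing id (Identity.isRingHomomorphism ℚ.+-*-rawRing ≡.refl)
  open ℚ³

  sum₃-*ˡ : ∀ d a₀ a₁ a₂ x₀ x₁ x₂ → let a = lookup (a₀ ∷ a₁ ∷ a₂ ∷ []); x = lookup (x₀ ∷ x₁ ∷ x₂ ∷ []) in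
    sum₃ (λ j → a j ℚ.* (d ℚ.* x j)) ≡ d ℚ.* sum₃ (λ j → a j ℚ.* x j)
  sum₃-*ˡ = solve 7 (λ d a₀ a₁ a₂ x₀ x₁ x₂ →
    let a = lookup (a₀ ∷ a₁ ∷ a₂ ∷ []); x = lookup (x₀ ∷ x₁ ∷ x₂ ∷ []) in
    Poly.sum₃ 7 (λ j → a j :* (d :* x j)) := d :* Poly.sum₃ 7 (λ j → a j :* x j)) ≡.refl

  private
    rebase₂-lincombᴾ rebase₃-lincombᴾ : Fin 3 → (γ₀ γ₁ γ₂ m₀ m₁ m₂ : Polynomial 6) →
                                        Polynomial 6 × Polynomial 6
    rebase₂-lincombᴾ i γ₀ γ₁ γ₂ m₀ m₁ m₂ = Poly.coord 6 (rebase₂ (Poly.lincomb 6 m basis₂)) i := γ₂ :* m i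
      where
      open Poly.Frames 6 γ₀ γ₁ γ₂
      m = lookup (m₀ ∷ m₁ ∷ m₂ ∷ [])
    rebase₃-lincombᴾ i γ₀ γ₁ γ₂ m₀ m₁ m₂ = Poly.coord 6 (rebase₃ (Poly.lincomb 6 m basis₃)) i := γ₂ :* m i
      where
      open Poly.Frames 6 γ₀ γ₁ γ₂
      m = lookup (m₀ ∷ m₁ ∷ m₂ ∷ [])

    rebase₂-lincombⁱ : ∀ i γ₀ γ₁ γ₂ m₀ m₁ m₂ → let open Frames γ₀ γ₁ γ₂; m = lookup (m₀ ∷ m₁ ∷ m₂ ∷ []) in
      coord (rebase₂ (lincomb m basis₂)) i ≡ γ₂ ℚ.* m i
    rebase₂-lincombⁱ zero = solve 6 (rebase₂-lincombᴾ zero) ≡.refl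
    rebase₂-lincombⁱ (suc zero) = solve 6 (rebase₂-lincombᴾ (suc zero)) ≡.refl
    rebase₂-lincombⁱ (suc (suc zero)) = solve 6 (rebase₂-lincombᴾ (suc (suc zero))) ≡.refl

    rebase₃-lincombⁱ : ∀ i γ₀ γ₁ γ₂ m₀ m₁ m₂ → let open Frames γ₀ γ₁ γ₂; m = lookup (m₀ ∷ m₁ ∷ m₂ ∷ []) in
      coord (rebase₃ (lincomb m basis₃)) i ≡ γ₂ ℚ.* m i
    rebase₃-lincombⁱ zero = solve 6 (rebase₃-lincombᴾ zero) ≡.refl
    rebase₃-lincombⁱ (suc zero) = solve 6 (rebase₃-lincombᴾ (suc zero)) ≡.refl
    rebase₃-lincombⁱ (suc (suc zero)) = solve 6 (rebase₃-lincombᴾ (suc (suc zero))) ≡.refl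

  frame₂ frame₃ : ∀ γ₀ γ₁ γ₂ → γ₂ ≢ 0ℚ → Frame
  frame₂ γ₀ γ₁ γ₂ γ₂≢0 = record
    { basis = basis₂ ; rebase = rebase₂ ; scale = γ₂ ; scale≢0 = γ₂≢0
    ; rebase-lincomb = λ m i →
        ≡.trans (rebase₂-lincombⁱ i γ₀ γ₁ γ₂ (m zero) (m (suc zero)) (m (suc (suc zero))))
                (≡.cong (γ₂ ℚ.*_) (Vec.lookup∘tabulate m i)) }
    where open Frames γ₀ γ₁ γ₂
  frame₃ γ₀ γ₁ γ₂ γ₂≢0 = record
    { basis = basis₃ ; rebase = rebase₃ ; scale = γ₂ ; scale≢0 = γ₂≢0
    ; rebase-lincomb = λ m i →
        ≡.trans (rebase₃-lincombⁱ i γ₀ γ₁ γ₂ (m zero) (m (suc zero)) (m (suc (suc zero))))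
                (≡.cong (γ₂ ℚ.*_) (Vec.lookup∘tabulate m i)) }
    where open Frames γ₀ γ₁ γ₂

  private
    relation₂ᴾ relation₃ᴾ : Fin 3 → Fin 3 → (α₀ α₁ α₂ γ₀ γ₁ γ₂ q₀ q₁ q₂ : Polynomial 9) →
                            Polynomial 9 × Polynomial 9
    relation₂ᴾ k i α₀ α₁ α₂ γ₀ γ₁ γ₂ q₀ q₁ q₂ = P k i := Poly.sum₃ 9 (λ j → Q₂ i k j :* P j (suc zero))
      where
      open Poly.Frames 9 γ₀ γ₁ γ₂
      open Poly.Constants 9 α₀ α₁ α₂ γ₀ γ₁ γ₂
      P = Poly.Cubic.multiplicationMatrix 9 α₀ α₁ α₂ rebase₂ basis₂ (lookup (q₀ ∷ q₁ ∷ q₂ ∷ []))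
    relation₃ᴾ k i α₀ α₁ α₂ γ₀ γ₁ γ₂ q₀ q₁ q₂ = P k i := Poly.sum₃ 9 (λ j → Q₃ i k j :* P j (suc (suc zero)))
      where
      open Poly.Frames 9 γ₀ γ₁ γ₂
      open Poly.Constants 9 α₀ α₁ α₂ γ₀ γ₁ γ₂
      P = Poly.Cubic.multiplicationMatrix 9 α₀ α₁ α₂ rebase₃ basis₃ (lookup (q₀ ∷ q₁ ∷ q₂ ∷ []))

  Q₂-relation : ∀ k i α₀ α₁ α₂ γ₀ γ₁ γ₂ q₀ q₁ q₂ →
    let open Frames γ₀ γ₁ γ₂
        P = Cubic.multiplicationMatrix α₀ α₁ α₂ rebase₂ basis₂ (lookup (q₀ ∷ q₁ ∷ q₂ ∷ []))
    in P k i ≡ Σ3ℚ (λ j → Consts.Q2 α₀ α₁ α₂ γ₀ γ₁ γ₂ i k j ℚ.* P j (suc zero))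
  Q₂-relation zero zero = solve 9 (relation₂ᴾ zero zero) ≡.refl
  Q₂-relation zero (suc zero) = solve 9 (relation₂ᴾ zero (suc zero)) ≡.refl
  Q₂-relation zero (suc (suc zero)) = solve 9 (relation₂ᴾ zero (suc (suc zero))) ≡.refl
  Q₂-relation (suc zero) zero = solve 9 (relation₂ᴾ (suc zero) zero) ≡.refl
  Q₂-relation (suc zero) (suc zero) = solve 9 (relation₂ᴾ (suc zero) (suc zero)) ≡.refl
  Q₂-relation (suc zero) (suc (suc zero)) = solve 9 (relation₂ᴾ (suc zero) (suc (suc zero))) ≡.refl
  Q₂-relation (suc (suc zero)) zero = solve 9 (relation₂ᴾ (suc (suc zero)) zero) ≡.refl
  Q₂-relation (suc (suc zero)) (suc zero) = solve 9 (relation₂ᴾ (suc (suc zero)) (suc zero)) ≡.refl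
  Q₂-relation (suc (suc zero)) (suc (suc zero)) = solve 9 (relation₂ᴾ (suc (suc zero)) (suc (suc zero))) ≡.refl

  Q₃-relation : ∀ k i α₀ α₁ α₂ γ₀ γ₁ γ₂ q₀ q₁ q₂ →
    let open Frames γ₀ γ₁ γ₂
        P = Cubic.multiplicationMatrix α₀ α₁ α₂ rebase₃ basis₃ (lookup (q₀ ∷ q₁ ∷ q₂ ∷ []))
    in P k i ≡ Σ3ℚ (λ j → Consts.Q3 α₀ α₁ α₂ γ₀ γ₁ γ₂ i k j ℚ.* P j (suc (suc zero)))
  Q₃-relation zero zero = solve 9 (relation₃ᴾ zero zero) ≡.refl
  Q₃-relation zero (suc zero) = solve 9 (relation₃ᴾ zero (suc zero)) ≡.refl
  Q₃-relation zero (suc (suc zero)) = solve 9 (relation₃ᴾ zero (suc (suc zero))) ≡.refl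
  Q₃-relation (suc zero) zero = solve 9 (relation₃ᴾ (suc zero) zero) ≡.refl
  Q₃-relation (suc zero) (suc zero) = solve 9 (relation₃ᴾ (suc zero) (suc zero)) ≡.refl
  Q₃-relation (suc zero) (suc (suc zero)) = solve 9 (relation₃ᴾ (suc zero) (suc (suc zero))) ≡.refl
  Q₃-relation (suc (suc zero)) zero = solve 9 (relation₃ᴾ (suc (suc zero)) zero) ≡.refl
  Q₃-relation (suc (suc zero)) (suc zero) = solve 9 (relation₃ᴾ (suc (suc zero)) (suc zero)) ≡.refl
  Q₃-relation (suc (suc zero)) (suc (suc zero)) = solve 9 (relation₃ᴾ (suc (suc zero)) (suc (suc zero))) ≡.refl

module ColumnRelation (α₀ α₁ α₂ : ℚ) (F : Frame) (l : Fin 3) (Q : Triple) where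
  open Frame F
  open ℚ³.Cubic α₀ α₁ α₂

  Holds : Set
  Holds = ∀ q k i → multiplicationMatrix rebase basis q k i
                     ≡ Σ3ℚ (λ j → Q i k j ℚ.* multiplicationMatrix rebase basis q j l)

  for-matrix : Holds → ∀ q (M : Mat) → (∀ k → ℚ³.lincomb (M k) basis ≡ ℚ³.lincomb q basis ⊙ basis k) →
    ∀ i k → M k i ≡ Σ3ℚ (λ j → Q i k j ℚ.* M j l)
  for-matrix holds q M rows i k = *-cancelˡ scale≢0 (begin
    scale ℚ.* M k i
      ≡⟨ scaled k i ⟩
    P k i
      ≡⟨ holds q k i ⟩
    Σ3ℚ (λ j → Q i k j ℚ.* P j l)
      ≡⟨ ≡.cong₂ ℚ._+_ (cong-Q zero) (≡.cong₂ ℚ._+_ (cong-Q (suc zero)) (cong-Q (suc (suc zero)))) ⟨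
    Σ3ℚ (λ j → Q i k j ℚ.* (scale ℚ.* M j l))
      ≡⟨ ℚ-Identities.sum₃-*ˡ scale (Q i k zero) (Q i k (suc zero)) (Q i k (suc (suc zero)))
                                    (M zero l) (M (suc zero) l) (M (suc (suc zero)) l) ⟩
    scale ℚ.* Σ3ℚ (λ j → Q i k j ℚ.* M j l) ∎)
    where
    open ≡.≡-Reasoning
    P = multiplicationMatrix rebase basis q
    scaled : ∀ k i → scale ℚ.* M k i ≡ P k i
    scaled k i = ≡.trans (≡.sym (rebase-lincomb (M k) i)) (≡.cong (λ c → ℚ³.coord (rebase c) i) (rows k))
    cong-Q : ∀ j → Q i k j ℚ.* (scale ℚ.* M j l) ≡ Q i k j ℚ.* P j l
    cong-Q j = ≡.cong (Q i k j ℚ.*_) (scaled j l)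

exprRawRing : ∀ {c ℓ} → RawRing c ℓ → ℕ → RawRing c c
exprRawRing A n = record
  { Carrier = Expr (RawRing.Carrier A) n ; _≈_ = _≡_ ; _+_ = _⊕_ ; _*_ = _⊗_ ; -_ = ⊝_
  ; 0# = Κ (RawRing.0# A) ; 1# = Κ (RawRing.1# A) }

module QAlgebra {c ℓ} (R : CommutativeRing c ℓ)
  (ι : ℚ → CommutativeRing.Carrier R) (ι-hom : Ambient.IsQAlgebra R ι) where
  open CommutativeRing R hiding (zero)
  open IsRingHomomorphism ι-hom
  open QAlgebraSolver R ι ι-hom
  open Coordinates rawRing hiding (_-_)

  eval-⊙ : ∀ α₀ α₁ α₂ a₀ a₁ a₂ b₀ b₁ b₂ Y → let open Cubic α₀ α₁ α₂ in
    eval (a₀ , a₁ , a₂) Y * eval (b₀ , b₁ , b₂) Y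
      ≈ eval ((a₀ , a₁ , a₂) ⊙ (b₀ , b₁ , b₂)) Y + quotient (a₀ , a₁ , a₂) (b₀ , b₁ , b₂) Y * minimal Y
  eval-⊙ = solve 10 (λ α₀ α₁ α₂ a₀ a₁ a₂ b₀ b₁ b₂ Y → let open Poly.Cubic 10 α₀ α₁ α₂ in
    Poly.eval 10 (a₀ , a₁ , a₂) Y :* Poly.eval 10 (b₀ , b₁ , b₂) Y
      := (Poly.eval 10 ((a₀ , a₁ , a₂) ⊙ (b₀ , b₁ , b₂)) Y
          :+ quotient (a₀ , a₁ , a₂) (b₀ , b₁ , b₂) Y :* minimal Y)) refl

  eval-lincomb : ∀ m₀ m₁ m₂ a₀ a₁ a₂ b₀ b₁ b₂ d₀ d₁ d₂ Y →
    let m = lookup (m₀ ∷ m₁ ∷ m₂ ∷ [])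
        W = lookup ((a₀ , a₁ , a₂) ∷ (b₀ , b₁ , b₂) ∷ (d₀ , d₁ , d₂) ∷ [])
    in sum₃ (λ j → m j * eval (W j) Y) ≈ eval (lincomb m W) Y
  eval-lincomb = solve 13 (λ m₀ m₁ m₂ a₀ a₁ a₂ b₀ b₁ b₂ d₀ d₁ d₂ Y →
    let m = lookup (m₀ ∷ m₁ ∷ m₂ ∷ [])
        W = lookup ((a₀ , a₁ , a₂) ∷ (b₀ , b₁ , b₂) ∷ (d₀ , d₁ , d₂) ∷ [])
    in Poly.sum₃ 13 (λ j → m j :* Poly.eval 13 (W j) Y) := Poly.eval 13 (Poly.lincomb 13 m W) Y) refl

  eval-⊖ : ∀ a₀ a₁ a₂ b₀ b₁ b₂ Y →
    eval ((a₀ , a₁ , a₂) ⊖ (b₀ , b₁ , b₂)) Y ≈ eval (a₀ , a₁ , a₂) Y - eval (b₀ , b₁ , b₂) Y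
  eval-⊖ = solve 7 (λ a₀ a₁ a₂ b₀ b₁ b₂ Y →
    Poly.eval 7 (Poly._⊖_ 7 (a₀ , a₁ , a₂) (b₀ , b₁ , b₂)) Y
      := Poly._-_ 7 (Poly.eval 7 (a₀ , a₁ , a₂) Y) (Poly.eval 7 (b₀ , b₁ , b₂) Y)) refl

  eval-1 : ∀ Y → eval (ι 1ℚ , ι 0ℚ , ι 0ℚ) Y ≈ ι 1ℚ
  eval-1 = solve 1 (λ Y → Poly.eval 1 (con 1ℚ , con 0ℚ , con 0ℚ) Y := con 1ℚ) refl

  eval-Y : ∀ Y → eval (ι 0ℚ , ι 1ℚ , ι 0ℚ) Y ≈ Y
  eval-Y = solve 1 (λ Y → Poly.eval 1 (con 0ℚ , con 1ℚ , con 0ℚ) Y := Y) refl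

  open Eval ℚ.+-*-rawRing id renaming (⟦_⟧ to ℚ⟦_⟧)
  open Eval rawRing ι renaming (⟦_⟧ to ι⟦_⟧)

  ι-⟦⟧ : ∀ {n} (e : Expr ℚ n) ρ → ι (ℚ⟦ e ⟧ ρ) ≈ ι⟦ e ⟧ (Vec.map ι ρ)
  ι-⟦⟧ (Κ x) ρ = refl
  ι-⟦⟧ (Ι i) ρ = reflexive (≡.sym (Vec.lookup-map i ι ρ))
  ι-⟦⟧ (e₁ ⊕ e₂) ρ = trans (+-homo _ _) (+-cong (ι-⟦⟧ e₁ ρ) (ι-⟦⟧ e₂ ρ))
  ι-⟦⟧ (e₁ ⊗ e₂) ρ = trans (*-homo _ _) (*-cong (ι-⟦⟧ e₁ ρ) (ι-⟦⟧ e₂ ρ))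
  ι-⟦⟧ (⊝ e) ρ = trans (-‿homo _) (-‿cong (ι-⟦⟧ e ρ))
  ι-⟦⟧ (e ⊛ k) ρ = ι-^ k
    where
    ι-^ : ∀ k → ι (ℚ⟦ e ⊛ k ⟧ ρ) ≈ ι⟦ e ⊛ k ⟧ (Vec.map ι ρ)
    ι-^ 0 = 1#-homo
    ι-^ 1 = ι-⟦⟧ e ρ
    ι-^ (ℕ.suc (ℕ.suc k)) = trans (*-homo _ _) (*-cong (ι-^ (ℕ.suc k)) (ι-⟦⟧ e ρ))

  -- For e a generic formula instantiated at syntax, the two sides are definitionally ι
  -- of the formula over ℚ and the formula over R at the ι-images of the variables.
  eval-ι-⟦⟧ : ∀ {n} (e : Coordinates.Coords (exprRawRing ℚ.+-*-rawRing n)) ρ Y →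
    eval (map₃ ι (map₃ (λ eᵢ → ℚ⟦ eᵢ ⟧ ρ) e)) Y ≈ eval (map₃ (λ eᵢ → ι⟦ eᵢ ⟧ (Vec.map ι ρ)) e) Y
  eval-ι-⟦⟧ (e₀ , e₁ , e₂) ρ Y =
    +-cong (+-cong (ι-⟦⟧ e₀ ρ) (*-cong (ι-⟦⟧ e₁ ρ) refl)) (*-cong (ι-⟦⟧ e₂ ρ) refl)

  module CubicElement (α₀ α₁ α₂ : ℚ) (y : Carrier)
    (root : Ambient.IsRoot R ι α₀ α₁ α₂ y) (independent : Ambient.Deg≥3 R ι y) where
    open ℚ³.Cubic α₀ α₁ α₂ using (_⊙_)
    open ≈-Reasoning setoid
    private
      module Rᶜ = Cubic (ι α₀) (ι α₁) (ι α₂)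
      module Term (n : ℕ) = Coordinates (exprRawRing ℚ.+-*-rawRing n)

    embed : ℚ³.Coords → Carrier
    embed u = eval (map₃ ι u) y

    embed-⊙ : ∀ u w → embed u * embed w ≈ embed (u ⊙ w)
    embed-⊙ u@(a₀ , a₁ , a₂) w@(b₀ , b₁ , b₂) = begin
      embed u * embed w
        ≈⟨ eval-⊙ (ι α₀) (ι α₁) (ι α₂) (ι a₀) (ι a₁) (ι a₂) (ι b₀) (ι b₁) (ι b₂) y ⟩
      eval (ιu Rᶜ.⊙ ιw) y + Rᶜ.quotient ιu ιw y * Rᶜ.minimal y
        ≈⟨ +-cong refl (trans (*-cong refl root) (zeroʳ _)) ⟩
      eval (ιu Rᶜ.⊙ ιw) y + 0#
        ≈⟨ +-identityʳ _ ⟩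
      eval (ιu Rᶜ.⊙ ιw) y
        ≈⟨ eval-ι-⟦⟧ (Term.Cubic._⊙_ 9 (Ι (# 0)) (Ι (# 1)) (Ι (# 2))
                        (Ι (# 3) , Ι (# 4) , Ι (# 5)) (Ι (# 6) , Ι (# 7) , Ι (# 8)))
                     (α₀ ∷ α₁ ∷ α₂ ∷ a₀ ∷ a₁ ∷ a₂ ∷ b₀ ∷ b₁ ∷ b₂ ∷ []) y ⟨
      embed (u ⊙ w) ∎
      where
      ιu = map₃ ι u
      ιw = map₃ ι w

    embed-lincomb : ∀ m u₀ u₁ u₂ → let W = lookup (u₀ ∷ u₁ ∷ u₂ ∷ []) in
      sum₃ (λ j → ι (m j) * embed (W j)) ≈ embed (ℚ³.lincomb m W)
    embed-lincomb m u₀@(a₀ , a₁ , a₂) u₁@(b₀ , b₁ , b₂) u₂@(d₀ , d₁ , d₂) = begin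
      sum₃ (λ j → ι (m j) * embed (W j))
        ≈⟨ eval-lincomb (ι m₀) (ι m₁) (ι m₂) (ι a₀) (ι a₁) (ι a₂) (ι b₀) (ι b₁) (ι b₂) (ι d₀) (ι d₁) (ι d₂) y ⟩
      eval (lincomb (ι ∘ m) (map₃ ι ∘ W)) y
        ≈⟨ eval-ι-⟦⟧ (Term.lincomb 12 (lookup (Ι (# 0) ∷ Ι (# 1) ∷ Ι (# 2) ∷ []))
                        (lookup ((Ι (# 3) , Ι (# 4) , Ι (# 5)) ∷ (Ι (# 6) , Ι (# 7) , Ι (# 8))
                                  ∷ (Ι (# 9) , Ι (# 10) , Ι (# 11)) ∷ [])))
                     (m₀ ∷ m₁ ∷ m₂ ∷ a₀ ∷ a₁ ∷ a₂ ∷ b₀ ∷ b₁ ∷ b₂ ∷ d₀ ∷ d₁ ∷ d₂ ∷ []) y ⟨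
      embed (ℚ³.lincomb m W) ∎
      where
      W = lookup (u₀ ∷ u₁ ∷ u₂ ∷ [])
      m₀ = m zero
      m₁ = m (suc zero)
      m₂ = m (suc (suc zero))

    embed-⊖ : ∀ u w → embed (u ℚ³.⊖ w) ≈ embed u - embed w
    embed-⊖ u@(a₀ , a₁ , a₂) w@(b₀ , b₁ , b₂) = begin
      embed (u ℚ³.⊖ w)
        ≈⟨ eval-ι-⟦⟧ (Term._⊖_ 6 (Ι (# 0) , Ι (# 1) , Ι (# 2)) (Ι (# 3) , Ι (# 4) , Ι (# 5)))
                     (a₀ ∷ a₁ ∷ a₂ ∷ b₀ ∷ b₁ ∷ b₂ ∷ []) y ⟩
      eval (map₃ ι u ⊖ map₃ ι w) y
        ≈⟨ eval-⊖ (ι a₀) (ι a₁) (ι a₂) (ι b₀) (ι b₁) (ι b₂) y ⟩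
      embed u - embed w ∎

    embed-injective : ∀ u w → embed u ≈ embed w → u ≡ w
    embed-injective u@(a₀ , a₁ , a₂) w@(b₀ , b₁ , b₂) eq =
      let e₀ , e₁ , e₂ = independent (a₀ ℚ.- b₀) (a₁ ℚ.- b₁) (a₂ ℚ.- b₂) difference≈0
      in ≡.cong₂ _,_ (ℚ-Group.x∙y⁻¹≈ε⇒x≈y _ _ e₀)
           (≡.cong₂ _,_ (ℚ-Group.x∙y⁻¹≈ε⇒x≈y _ _ e₁) (ℚ-Group.x∙y⁻¹≈ε⇒x≈y _ _ e₂))
      where
      difference≈0 : embed (u ℚ³.⊖ w) ≈ 0#
      difference≈0 = begin
        embed (u ℚ³.⊖ w)   ≈⟨ embed-⊖ u w ⟩
        embed u - embed w  ≈⟨ +-cong eq refl ⟩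
        embed w - embed w  ≈⟨ -‿inverseʳ _ ⟩
        0#                 ∎

    1≈embed : 1# ≈ embed (1ℚ , 0ℚ , 0ℚ)
    1≈embed = trans (sym 1#-homo) (sym (eval-1 y))

    y≈embed : y ≈ embed (0ℚ , 1ℚ , 0ℚ)
    y≈embed = sym (eval-Y y)

    module _ (v : Fin 3 → Carrier) (W : Fin 3 → ℚ³.Coords) (v≈W : ∀ j → v j ≈ embed (W j)) where

      sum-embed : ∀ m → Ambient.Σ3 R ι (λ j → ι (m j) * v j) ≈ embed (ℚ³.lincomb m W)
      sum-embed m = begin
        sum₃ (λ j → ι (m j) * v j)
          ≈⟨ +-cong (*-cong refl (v≈W zero))
                    (+-cong (*-cong refl (v≈W (suc zero))) (*-cong refl (v≈W (suc (suc zero))))) ⟩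
        sum₃ (λ j → ι (m j) * embed (W j))
          ≈⟨ embed-lincomb m (W zero) (W (suc zero)) (W (suc (suc zero))) ⟩
        embed (ℚ³.lincomb m W) ∎

      represents⇒coordinates : ∀ {z} q → z ≈ Ambient.Σ3 R ι (λ j → ι (q j) * v j) →
        ∀ M → Ambient.Represents R ι M z v → ∀ k → ℚ³.lincomb (M k) W ≡ ℚ³.lincomb q W ⊙ W k
      represents⇒coordinates {z} q z≈ M Mv≈zv k = embed-injective _ _ (begin
        embed (ℚ³.lincomb (M k) W)            ≈⟨ sum-embed (M k) ⟨
        sum₃ (λ j → ι (M k j) * v j)          ≈⟨ Mv≈zv k ⟩
        z * v k                               ≈⟨ *-cong (trans z≈ (sum-embed q)) (v≈W k) ⟩
        embed (ℚ³.lincomb q W) * embed (W k)  ≈⟨ embed-⊙ _ _ ⟩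
        embed (ℚ³.lincomb q W ⊙ W k)          ∎)

    isQ : ∀ F l v Q → (∀ j → v j ≈ embed (Frame.basis F j)) → ColumnRelation.Holds α₀ α₁ α₂ F l Q →
      Ambient.IsQ R ι l v Q
    isQ F l v Q v≈basis holds z (q , z≈) M Mv≈zv =
      ColumnRelation.for-matrix α₀ α₁ α₂ F l Q holds q M
        (represents⇒coordinates v (Frame.basis F) v≈basis q z≈ M Mv≈zv)

proposition3p8 : ∀ {c ℓ : Level} (R : CommutativeRing c ℓ)
    (ι : ℚ → CommutativeRing.Carrier R) → Ambient.IsQAlgebra R ι →
    (α₀ α₁ α₂ γ₀ γ₁ γ₂ : ℚ) (y : CommutativeRing.Carrier R) →
    Ambient.IsRoot R ι α₀ α₁ α₂ y → Ambient.Deg≥3 R ι y → γ₂ ≢ 0ℚ →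
    Ambient.IsQ R ι (suc zero)
      (Ambient.vec R ι (CommutativeRing.1# R) (Ambient.xOf R ι γ₀ γ₁ γ₂ y) y)
      (Consts.Q2 α₀ α₁ α₂ γ₀ γ₁ γ₂)
    × Ambient.IsQ R ι (suc (suc zero))
      (Ambient.vec R ι y (CommutativeRing.1# R) (Ambient.xOf R ι γ₀ γ₁ γ₂ y))
      (Consts.Q3 α₀ α₁ α₂ γ₀ γ₁ γ₂)
proposition3p8 R ι ι-hom α₀ α₁ α₂ γ₀ γ₁ γ₂ y root independent γ₂≢0 =
    isQ (frame₂ γ₀ γ₁ γ₂ γ₂≢0) (suc zero) _ (Consts.Q2 α₀ α₁ α₂ γ₀ γ₁ γ₂) v₂≈basis₂
      (λ q k i → Q₂-relation k i α₀ α₁ α₂ γ₀ γ₁ γ₂ (q zero) (q (suc zero)) (q (suc (suc zero))))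
  , isQ (frame₃ γ₀ γ₁ γ₂ γ₂≢0) (suc (suc zero)) _ (Consts.Q3 α₀ α₁ α₂ γ₀ γ₁ γ₂) v₃≈basis₃
      (λ q k i → Q₃-relation k i α₀ α₁ α₂ γ₀ γ₁ γ₂ (q zero) (q (suc zero)) (q (suc (suc zero))))
  where
  open CommutativeRing R using (_≈_; refl)
  open QAlgebra R ι ι-hom using (module CubicElement)
  open CubicElement α₀ α₁ α₂ y root independent
  open ℚ-Identities using (frame₂; frame₃; Q₂-relation; Q₃-relation)
  open ℚ³.Frames γ₀ γ₁ γ₂ using (basis₂; basis₃)
  x = Ambient.xOf R ι γ₀ γ₁ γ₂ y

  v₂≈basis₂ : ∀ j → Ambient.vec R ι (CommutativeRing.1# R) x y j ≈ embed (basis₂ j)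
  v₂≈basis₂ zero = 1≈embed
  v₂≈basis₂ (suc zero) = refl
  v₂≈basis₂ (suc (suc zero)) = y≈embed

  v₃≈basis₃ : ∀ j → Ambient.vec R ι y (CommutativeRing.1# R) x j ≈ embed (basis₃ j)
  v₃≈basis₃ zero = y≈embed
  v₃≈basis₃ (suc zero) = 1≈embed
  v₃≈basis₃ (suc (suc zero)) = refl
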